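{- Let $k\in[M]$. (i) Let $\mathcal{T}_1$ be a $k$-dimensional multi-transversal on $\prod_{j=1}^M[n^{(1)}_j]^{\star}$ with parameters $\{L^{(1)}_P\}$ and $\mathcal{T}_2$ a $k$-dimensional multi-transversal on $\prod_{j=1}^M[n^{(2)}_j]^{\star}$ with parameters $\{L^{(2)}_P\}$ ($P\in\binom{[M]}{k}$). Then the multiset $\mathcal{T}$ in which each vector $(a_1n^{(2)}_1+b_1,\ldots,a_Mn^{(2)}_M+b_M)$ has multiplicity $\#[(a_1,\ldots,a_M),\mathcal{T}_1]\cdot\#[(b_1,\ldots,b_M),\mathcal{T}_2]$ is a $k$-dimensional multi-transversal on $\prod_{j=1}^M[n^{(1)}_jn^{(2)}_j]^{\star}$ with parameters $L_P=L^{(1)}_PL^{(2)}_P$. (ii) If moreover $\mathcal{T}_1,\mathcal{T}_2$ are full and there is an $A\in\binom{[M]}{k}$ such that for $i\in\{1,2\}$, $L^{(i)}_A\prod_{j\notin A}n^{(i)}_j=\min_{P}\big(L^{(i)}_P\prod_{j\notin P}n^{(i)}_j\big)$, then $\mathcal{T}$ is full.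
   Context: $[n]^{\star}=\{0,\ldots,n-1\}$; $\#[v,\mathcal{T}]$ is the multiplicity of $v$ in a multiset $\mathcal{T}$. For positive integers $n_1,\ldots,n_M$, a $k$-dimensional multi-transversal on $\prod_j[n_j]^{\star}$ with parameters $\{L_P\}$ is a multiset $\mathcal{T}$ on $\prod_j[n_j]^{\star}$ such that for every $P\in\binom{[M]}{k}$ and every choice of $b_j\in[n_j]^{\star}$ ($j\notin P$), the number of elements (with multiplicity) with $j$-th coordinate $b_j$ for all $j\notin P$ is at most $L_P$. It is full if $|\mathcal{T}|=L_P\prod_{j\notin P}n_j$ for at least one $P$. -}

module Defs where

open import Data.Nat using (ℕ; zero; suc; _+_; _*_; _≤_; _<_)
open import Data.Bool using (Bool; true; false; _∧_)
open import Data.List using (List; []; _∷_; concatMap; map; filterᵇ; upTo)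
open import Data.Nat.ListAction using (sum)
open import Data.Vec using (Vec; []; _∷_; zipWith)
open import Data.Fin.Subset using (Subset)
open import Data.Nat using (_≡ᵇ_)
open import Data.Product using (Σ; ∃; _×_; _,_)
open import Relation.Binary.PropositionalEquality using (_≡_)

box : ∀ {M} → Vec ℕ M → List (Vec ℕ M)
box []       = [] ∷ []
box (n ∷ ns) = concatMap (λ x → map (x ∷_) (box ns)) (upTo n)

-- A multiset on the box ∏_j [n_j]* is given by its multiplicity function
-- #[v, T] = T v ; only the values on the box are relevant.
Multiset : ℕ → Set
Multiset M = Vec ℕ M → ℕ

size : ∀ {M} → Vec ℕ M → Multiset M → ℕ
size n T = sum (map T (box n))

agreeOutside : ∀ {M} → Subset M → Vec ℕ M → Vec ℕ M → Bool
agreeOutside []           []       []       = true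
agreeOutside (true  ∷ P) (_ ∷ v) (_ ∷ c) = agreeOutside P v c
agreeOutside (false ∷ P) (x ∷ v) (y ∷ c) = (x ≡ᵇ y) ∧ agreeOutside P v c

lineCount : ∀ {M} → Vec ℕ M → Multiset M → Subset M → Vec ℕ M → ℕ
lineCount n T P c = sum (map T (filterᵇ (λ v → agreeOutside P v c) (box n)))

prodOutside : ∀ {M} → Subset M → Vec ℕ M → ℕ
prodOutside []          []       = 1
prodOutside (true  ∷ P) (_ ∷ n) = prodOutside P n
prodOutside (false ∷ P) (x ∷ n) = x * prodOutside P n

open import Data.Fin.Subset using (∣_∣)
_HasSize_ : ∀ {M} → Subset M → ℕ → Set
P HasSize k = ∣ P ∣ ≡ k

-- k-dimensional multi-transversal on ∏_j [n_j]* with parameters L.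
-- The choice b_j ∈ [n_j]* (j ∉ P) is given by a vector c in the box; its
-- coordinates at j ∈ P are irrelevant.
open import Data.List.Membership.Propositional using (_∈_)
IsMultiTransversal : ∀ {M} → ℕ → Vec ℕ M → (Subset M → ℕ) → Multiset M → Set
IsMultiTransversal {M} k n L T =
  (P : Subset M) → P HasSize k → (c : Vec ℕ M) → c ∈ box n →
  lineCount n T P c ≤ L P

IsFull : ∀ {M} → ℕ → Vec ℕ M → (Subset M → ℕ) → Multiset M → Set
IsFull {M} k n L T =
  Σ (Subset M) λ P → P HasSize k × (size n T ≡ L P * prodOutside P n)

combine : ∀ {M} → Vec ℕ M → Vec ℕ M → Vec ℕ M → Vec ℕ M
combine a n b = zipWith _+_ (zipWith _*_ a n) b

Positive : ∀ {M} → Vec ℕ M → Set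
Positive [] = Data.Unit.⊤ where import Data.Unit
Positive (x ∷ n) = (0 < x) × Positive n

module Submission where

-- Every point of the box ∏_j [n¹_j n²_j]* is written uniquely as a mixed-radix
-- combination a·n² + b with a ∈ ∏_j [n¹_j]* and b ∈ ∏_j [n²_j]*.  Hence a sum
-- over the product box of a quantity of the form g₁(a)·g₂(b) factorises
-- (sumBox-factor).  Being on the line through a·n² + b in the direction P
-- means agreeing outside P digit by digit, so the line counts of T factorise
-- as (line count of T₁)·(line count of T₂); this gives part (i).
--
-- For part (ii), the box is partitioned into the lines in direction P, one for
-- every representative vector vanishing on P (sumBox-fibres); there are
-- ∏_{j∉P} n_j of them, so |T| ≤ L_P ∏_{j∉P} n_j for every transversal.  A full
-- transversal attains this bound at some P, hence at every minimiser A of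
-- L_P ∏_{j∉P} n_j.  The sizes of T₁, T₂ and T factorise as well, so T attains
-- the bound at A.

open import Defs
open import Data.Nat using (ℕ; zero; suc; _+_; _*_; _≤_; _<_; _≡ᵇ_; z≤n; s≤s)
open import Data.Nat.Properties
open import Data.Nat.DivMod using (_/_; _%_; m≡m%n+[m/n]*n; m%n<n; m<n*o⇒m/o<n; m<n⇒m%n≡m; [m+kn]%n≡m%n)
open import Data.Nat.ListAction using (sum)
open import Data.Nat.ListAction.Properties using (sum-++)
open import Data.Bool using (Bool; true; false; _∧_; if_then_else_; T)
open import Data.Bool.Properties using (T-∧; ∧-commutativeMonoid)
open import Data.List using (List; []; _∷_; _++_; map; concatMap; filterᵇ; upTo; length)
open import Data.List.Properties using (map-++; map-∘; map-cong; map-cong-local; map-upTo; length-upTo)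
open import Data.List.Relation.Unary.All using (tabulate)
open import Data.List.Relation.Unary.Any using (here; there)
open import Data.List.Membership.Propositional using (_∈_; find; lose)
open import Data.List.Membership.Propositional.Properties using (∈-map⁺; ∈-map⁻; ∈-concatMap⁺; ∈-concatMap⁻; ∈-upTo⁺; ∈-upTo⁻)
open import Data.Vec using (Vec; []; _∷_; zipWith)
open import Data.Vec.Relation.Binary.Pointwise.Inductive using (Pointwise; []; _∷_)
open import Data.Fin.Subset using (Subset)
open import Data.Product using (Σ; ∃-syntax; _×_; _,_)
open import Data.Empty using (⊥-elim)
open import Function using (_∘_; Equivalence)
open import Algebra.Bundles using (CommutativeMonoid)
import Algebra.Properties.CommutativeSemigroup as CommutativeSemigroupProperties
open import Relation.Binary.PropositionalEquality

open CommutativeSemigroupProperties +-commutativeSemigroup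
  using () renaming (interchange to +-interchange)
open CommutativeSemigroupProperties *-commutativeSemigroup
  using () renaming (interchange to *-interchange)
open CommutativeSemigroupProperties (CommutativeMonoid.commutativeSemigroup ∧-commutativeMonoid)
  using () renaming (interchange to ∧-interchange)

private
  variable
    A B : Set
    M : ℕ

sumOver : List A → (A → ℕ) → ℕ
sumOver xs f = sum (map f xs)

sumOver-cong : ∀ (xs : List A) {f g : A → ℕ} →
  (∀ x → x ∈ xs → f x ≡ g x) → sumOver xs f ≡ sumOver xs g
sumOver-cong xs f≡g = cong sum (map-cong-local (tabulate (λ {x} → f≡g x)))

sumOver-≗ : ∀ (xs : List A) {f g : A → ℕ} →
  (∀ x → f x ≡ g x) → sumOver xs f ≡ sumOver xs g
sumOver-≗ xs f≡g = cong sum (map-cong f≡g xs)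

sumOver-mono : ∀ (xs : List A) {f g : A → ℕ} →
  (∀ x → x ∈ xs → f x ≤ g x) → sumOver xs f ≤ sumOver xs g
sumOver-mono []       f≤g = z≤n
sumOver-mono (x ∷ xs) f≤g = +-mono-≤ (f≤g x (here refl)) (sumOver-mono xs (λ y → f≤g y ∘ there))

sumOver-const : ∀ (xs : List A) (c : ℕ) → sumOver xs (λ _ → c) ≡ length xs * c
sumOver-const []       c = refl
sumOver-const (x ∷ xs) c = cong (c +_) (sumOver-const xs c)

sumOver-zero : ∀ (xs : List A) → sumOver xs (λ _ → 0) ≡ 0
sumOver-zero xs = trans (sumOver-const xs 0) (*-zeroʳ (length xs))

sumOver-++ : ∀ (xs ys : List A) (f : A → ℕ) → sumOver (xs ++ ys) f ≡ sumOver xs f + sumOver ys f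
sumOver-++ xs ys f = trans (cong sum (map-++ f xs ys)) (sum-++ (map f xs) (map f ys))

sumOver-concatMap : ∀ (g : A → List B) xs (f : B → ℕ) →
  sumOver (concatMap g xs) f ≡ sumOver xs (λ x → sumOver (g x) f)
sumOver-concatMap g []       f = refl
sumOver-concatMap g (x ∷ xs) f =
  trans (sumOver-++ (g x) (concatMap g xs) f) (cong (sumOver (g x) f +_) (sumOver-concatMap g xs f))

sumOver-map : ∀ (g : A → B) xs (f : B → ℕ) → sumOver (map g xs) f ≡ sumOver xs (f ∘ g)
sumOver-map g xs f = cong sum (sym (map-∘ xs))

sumOver-+ : ∀ (xs : List A) (f g : A → ℕ) →
  sumOver xs (λ x → f x + g x) ≡ sumOver xs f + sumOver xs g
sumOver-+ []       f g = refl
sumOver-+ (x ∷ xs) f g =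
  trans (cong (f x + g x +_) (sumOver-+ xs f g)) (+-interchange (f x) (g x) _ _)

sumOver-swap : ∀ (xs : List A) (ys : List B) (f : A → B → ℕ) →
  sumOver xs (λ x → sumOver ys (f x)) ≡ sumOver ys (λ y → sumOver xs (λ x → f x y))
sumOver-swap []       ys f = sym (sumOver-zero ys)
sumOver-swap (x ∷ xs) ys f =
  trans (cong (sumOver ys (f x) +_) (sumOver-swap xs ys f))
        (sym (sumOver-+ ys (f x) (λ y → sumOver xs (λ x → f x y))))

sumOver-*ˡ : ∀ (xs : List A) c (f : A → ℕ) → sumOver xs (λ x → c * f x) ≡ c * sumOver xs f
sumOver-*ˡ []       c f = sym (*-zeroʳ c)
sumOver-*ˡ (x ∷ xs) c f =
  trans (cong (c * f x +_) (sumOver-*ˡ xs c f)) (sym (*-distribˡ-+ c (f x) _))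

sumOver-*ʳ : ∀ (xs : List A) c (f : A → ℕ) → sumOver xs (λ x → f x * c) ≡ sumOver xs f * c
sumOver-*ʳ []       c f = refl
sumOver-*ʳ (x ∷ xs) c f =
  trans (cong (f x * c +_) (sumOver-*ʳ xs c f)) (sym (*-distribʳ-+ c (f x) _))

sumOver-separable : ∀ (xs : List A) (ys : List B) (f : A → ℕ) (g : B → ℕ) →
  sumOver xs (λ x → sumOver ys (λ y → f x * g y)) ≡ sumOver xs f * sumOver ys g
sumOver-separable xs ys f g =
  trans (sumOver-≗ xs (λ x → sumOver-*ˡ ys (f x) g)) (sumOver-*ʳ xs (sumOver ys g) f)

guard : Bool → ℕ → ℕ
guard b m = if b then m else 0

sumOver-filter : ∀ (p : A → Bool) xs (f : A → ℕ) →
  sumOver (filterᵇ p xs) f ≡ sumOver xs (λ x → guard (p x) (f x))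
sumOver-filter p []       f = refl
sumOver-filter p (x ∷ xs) f with p x
... | true  = cong (f x +_) (sumOver-filter p xs f)
... | false = sumOver-filter p xs f

sumOver-guard : ∀ b (xs : List A) (f : A → ℕ) → sumOver xs (λ x → guard b (f x)) ≡ guard b (sumOver xs f)
sumOver-guard true  xs f = refl
sumOver-guard false xs f = sumOver-zero xs

guard-∧ : ∀ b b′ m → guard (b ∧ b′) m ≡ guard b (guard b′ m)
guard-∧ true  b′ m = refl
guard-∧ false b′ m = refl

guard-* : ∀ b b′ m m′ → guard (b ∧ b′) (m * m′) ≡ guard b m * guard b′ m′
guard-* true  true  m m′ = refl
guard-* true  false m m′ = sym (*-zeroʳ m)
guard-* false b′    m m′ = refl

sumUpTo : ℕ → (ℕ → ℕ) → ℕ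
sumUpTo x h = sumOver (upTo x) h

sumUpTo-suc : ∀ x (h : ℕ → ℕ) → sumUpTo (suc x) h ≡ h 0 + sumUpTo x (h ∘ suc)
sumUpTo-suc x h =
  cong (h 0 +_) (trans (cong (λ l → sumOver l h) (sym (map-upTo suc x))) (sumOver-map suc (upTo x) h))

sumUpTo-+ : ∀ m n (h : ℕ → ℕ) → sumUpTo (m + n) h ≡ sumUpTo m h + sumUpTo n (λ i → h (m + i))
sumUpTo-+ zero    n h = refl
sumUpTo-+ (suc m) n h = begin
  sumUpTo (suc (m + n)) h                                        ≡⟨ sumUpTo-suc (m + n) h ⟩
  h 0 + sumUpTo (m + n) (h ∘ suc)                                ≡⟨ cong (h 0 +_) (sumUpTo-+ m n (h ∘ suc)) ⟩
  h 0 + (sumUpTo m (h ∘ suc) + sumUpTo n (λ i → h (suc m + i)))  ≡⟨ sym (+-assoc (h 0) _ _) ⟩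
  h 0 + sumUpTo m (h ∘ suc) + sumUpTo n (λ i → h (suc m + i))    ≡⟨ cong (_+ sumUpTo n (λ i → h (suc m + i))) (sym (sumUpTo-suc m h)) ⟩
  sumUpTo (suc m) h + sumUpTo n (λ i → h (suc m + i))            ∎
  where open ≡-Reasoning

sumUpTo-* : ∀ x₁ x₂ (h : ℕ → ℕ) →
  sumUpTo (x₁ * x₂) h ≡ sumUpTo x₁ (λ a → sumUpTo x₂ (λ b → h (a * x₂ + b)))
sumUpTo-* zero     x₂ h = refl
sumUpTo-* (suc x₁) x₂ h = begin
  sumUpTo (x₂ + x₁ * x₂) h
    ≡⟨ sumUpTo-+ x₂ (x₁ * x₂) h ⟩
  sumUpTo x₂ h + sumUpTo (x₁ * x₂) (λ i → h (x₂ + i))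
    ≡⟨ cong (sumUpTo x₂ h +_) (sumUpTo-* x₁ x₂ (λ i → h (x₂ + i))) ⟩
  sumUpTo x₂ h + sumUpTo x₁ (λ a → sumUpTo x₂ (λ b → h (x₂ + (a * x₂ + b))))
    ≡⟨ cong (sumUpTo x₂ h +_) (sumOver-≗ (upTo x₁) (λ a → sumOver-≗ (upTo x₂) (λ b →
         cong h (sym (+-assoc x₂ (a * x₂) b))))) ⟩
  sumUpTo x₂ h + sumUpTo x₁ (λ a → sumUpTo x₂ (λ b → h (suc a * x₂ + b)))
    ≡⟨ sym (sumUpTo-suc x₁ (λ a → sumUpTo x₂ (λ b → h (a * x₂ + b)))) ⟩
  sumUpTo (suc x₁) (λ a → sumUpTo x₂ (λ b → h (a * x₂ + b)))  ∎
  where open ≡-Reasoning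

sumUpTo-δ : ∀ {x j} (h : ℕ → ℕ) → j < x → sumUpTo x (λ i → guard (i ≡ᵇ j) (h i)) ≡ h j
sumUpTo-δ {suc x} {zero}  h _ = begin
  sumUpTo (suc x) (λ i → guard (i ≡ᵇ 0) (h i))  ≡⟨ sumUpTo-suc x (λ i → guard (i ≡ᵇ 0) (h i)) ⟩
  h 0 + sumUpTo x (λ _ → 0)                     ≡⟨ cong (h 0 +_) (sumOver-zero (upTo x)) ⟩
  h 0 + 0                                       ≡⟨ +-identityʳ (h 0) ⟩
  h 0                                           ∎
  where open ≡-Reasoning
sumUpTo-δ {suc x} {suc j} h (s≤s j<x) =
  trans (sumUpTo-suc x (λ i → guard (i ≡ᵇ suc j) (h i))) (sumUpTo-δ (h ∘ suc) j<x)

box-sound : ∀ (n v : Vec ℕ M) → v ∈ box n → Pointwise _<_ v n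
box-sound []      []      _ = []
box-sound (x ∷ n) (y ∷ v) y∷v∈box
  with i , i∈upTo , y∷v∈row ← find (∈-concatMap⁻ (λ i → map (i ∷_) (box n)) {xs = upTo x} y∷v∈box)
  with w , w∈box , refl ← ∈-map⁻ (i ∷_) y∷v∈row
  = ∈-upTo⁻ i∈upTo ∷ box-sound n w w∈box

box-complete : ∀ (n v : Vec ℕ M) → Pointwise _<_ v n → v ∈ box n
box-complete []      []      []            = here refl
box-complete (x ∷ n) (y ∷ v) (y<x ∷ v<n) =
  ∈-concatMap⁺ (λ i → map (i ∷_) (box n))
    (lose (∈-upTo⁺ y<x) (∈-map⁺ (y ∷_) (box-complete n v v<n)))

sumBox : Vec ℕ M → (Vec ℕ M → ℕ) → ℕ
sumBox n f = sumOver (box n) f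

sumBox-∷ : ∀ x (n : Vec ℕ M) (f : Vec ℕ (suc M) → ℕ) →
  sumBox (x ∷ n) f ≡ sumUpTo x (λ i → sumBox n (λ v → f (i ∷ v)))
sumBox-∷ x n f =
  trans (sumOver-concatMap (λ i → map (i ∷_) (box n)) (upTo x) f)
        (sumOver-≗ (upTo x) (λ i → sumOver-map (i ∷_) (box n) f))

sumBox-zipWith : ∀ (n₁ n₂ : Vec ℕ M) (g : Vec ℕ M → ℕ) →
  sumBox (zipWith _*_ n₁ n₂) g ≡ sumBox n₁ (λ a → sumBox n₂ (λ b → g (combine a n₂ b)))
sumBox-zipWith []         []         g = sym (+-identityʳ _)
sumBox-zipWith (x₁ ∷ n₁) (x₂ ∷ n₂) g = begin
  sumBox (x₁ * x₂ ∷ zipWith _*_ n₁ n₂) g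
    ≡⟨ sumBox-∷ (x₁ * x₂) (zipWith _*_ n₁ n₂) g ⟩
  sumUpTo (x₁ * x₂) (λ i → sumBox (zipWith _*_ n₁ n₂) (λ v → g (i ∷ v)))
    ≡⟨ sumUpTo-* x₁ x₂ _ ⟩
  sumUpTo x₁ (λ i → sumUpTo x₂ (λ j → sumBox (zipWith _*_ n₁ n₂) (λ v → g (i * x₂ + j ∷ v))))
    ≡⟨ sumOver-≗ (upTo x₁) (λ i → sumOver-≗ (upTo x₂) (λ j →
         sumBox-zipWith n₁ n₂ (λ v → g (i * x₂ + j ∷ v)))) ⟩
  sumUpTo x₁ (λ i → sumUpTo x₂ (λ j → sumBox n₁ (λ a → sumBox n₂ (λ b → g (i * x₂ + j ∷ combine a n₂ b)))))
    ≡⟨ sumOver-≗ (upTo x₁) (λ i → sumOver-swap (upTo x₂) (box n₁) _) ⟩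
  sumUpTo x₁ (λ i → sumBox n₁ (λ a → sumUpTo x₂ (λ j → sumBox n₂ (λ b → g (i * x₂ + j ∷ combine a n₂ b)))))
    ≡⟨ sumOver-≗ (upTo x₁) (λ i → sumOver-≗ (box n₁) (λ a →
         sym (sumBox-∷ x₂ n₂ (λ b → g (combine (i ∷ a) (x₂ ∷ n₂) b))))) ⟩
  sumUpTo x₁ (λ i → sumBox n₁ (λ a → sumBox (x₂ ∷ n₂) (λ b → g (combine (i ∷ a) (x₂ ∷ n₂) b))))
    ≡⟨ sym (sumBox-∷ x₁ n₁ (λ a → sumBox (x₂ ∷ n₂) (λ b → g (combine a (x₂ ∷ n₂) b)))) ⟩
  sumBox (x₁ ∷ n₁) (λ a → sumBox (x₂ ∷ n₂) (λ b → g (combine a (x₂ ∷ n₂) b)))  ∎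
  where open ≡-Reasoning

sumBox-factor : ∀ (n₁ n₂ : Vec ℕ M) (g g₁ g₂ : Vec ℕ M → ℕ) →
  (∀ a b → a ∈ box n₁ → b ∈ box n₂ → g (combine a n₂ b) ≡ g₁ a * g₂ b) →
  sumBox (zipWith _*_ n₁ n₂) g ≡ sumBox n₁ g₁ * sumBox n₂ g₂
sumBox-factor n₁ n₂ g g₁ g₂ splits = begin
  sumBox (zipWith _*_ n₁ n₂) g                          ≡⟨ sumBox-zipWith n₁ n₂ g ⟩
  sumBox n₁ (λ a → sumBox n₂ (λ b → g (combine a n₂ b)))
    ≡⟨ sumOver-cong (box n₁) (λ a a∈box → sumOver-cong (box n₂) (λ b b∈box → splits a b a∈box b∈box)) ⟩
  sumBox n₁ (λ a → sumBox n₂ (λ b → g₁ a * g₂ b))     ≡⟨ sumOver-separable (box n₁) (box n₂) g₁ g₂ ⟩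
  sumBox n₁ g₁ * sumBox n₂ g₂                           ∎
  where open ≡-Reasoning

digits-exist : ∀ x₁ x₂ {c} → c < x₁ * x₂ →
  ∃[ q ] ∃[ r ] q < x₁ × r < x₂ × c ≡ q * x₂ + r
digits-exist x₁ zero    {c} c<x₁x₂ = ⊥-elim (n≮0 (subst (c <_) (*-zeroʳ x₁) c<x₁x₂))
digits-exist x₁ (suc x) {c} c<x₁x₂ =
  c / suc x , c % suc x , m<n*o⇒m/o<n c<x₁x₂ , m%n<n c (suc x) ,
  trans (m≡m%n+[m/n]*n c (suc x)) (+-comm (c % suc x) _)

digits-injective : ∀ {x a b c d} → b < x → d < x → a * x + b ≡ c * x + d → a ≡ c × b ≡ d
digits-injective {suc x} {a} {b} {c} {d} b<x d<x eq = a≡c , b≡d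
  where
  remainder : ∀ q {r} → r < suc x → (q * suc x + r) % suc x ≡ r
  remainder q {r} r<x =
    trans (cong (_% suc x) (+-comm (q * suc x) r)) (trans ([m+kn]%n≡m%n r q (suc x)) (m<n⇒m%n≡m r<x))
  b≡d : b ≡ d
  b≡d = trans (sym (remainder a b<x)) (trans (cong (_% suc x) eq) (remainder c d<x))
  a≡c : a ≡ c
  a≡c = *-cancelʳ-≡ a c (suc x) (+-cancelʳ-≡ d (a * suc x) (c * suc x) (subst (λ r → a * suc x + r ≡ c * suc x + d) b≡d eq))

combine-surjective : ∀ (n₁ n₂ c : Vec ℕ M) → Pointwise _<_ c (zipWith _*_ n₁ n₂) →
  ∃[ c₁ ] ∃[ c₂ ] Pointwise _<_ c₁ n₁ × Pointwise _<_ c₂ n₂ × c ≡ combine c₁ n₂ c₂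
combine-surjective []         []         []      []              = [] , [] , [] , [] , refl
combine-surjective (x₁ ∷ n₁) (x₂ ∷ n₂) (y ∷ c) (y<x₁x₂ ∷ c<n)
  with q , r , q<x₁ , r<x₂ , y≡ ← digits-exist x₁ x₂ y<x₁x₂
  with c₁ , c₂ , c₁<n₁ , c₂<n₂ , c≡ ← combine-surjective n₁ n₂ c c<n
  = q ∷ c₁ , r ∷ c₂ , q<x₁ ∷ c₁<n₁ , r<x₂ ∷ c₂<n₂ , cong₂ _∷_ y≡ c≡

T-ext : ∀ {b b′} → (T b → T b′) → (T b′ → T b) → b ≡ b′
T-ext {false} {false} _ _ = refl
T-ext {false} {true}  _ g = ⊥-elim (g _)
T-ext {true}  {false} f _ = ⊥-elim (f _)
T-ext {true}  {true}  _ _ = refl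

digits-≡ᵇ : ∀ {x} a b c d → b < x → d < x →
  (a * x + b ≡ᵇ c * x + d) ≡ ((a ≡ᵇ c) ∧ (b ≡ᵇ d))
digits-≡ᵇ {x} a b c d b<x d<x = T-ext same⇒digits digits⇒same
  where
  same⇒digits : T (a * x + b ≡ᵇ c * x + d) → T ((a ≡ᵇ c) ∧ (b ≡ᵇ d))
  same⇒digits t with a≡c , b≡d ← digits-injective b<x d<x (≡ᵇ⇒≡ _ _ t) =
    Equivalence.from T-∧ (≡⇒≡ᵇ a c a≡c , ≡⇒≡ᵇ b d b≡d)
  digits⇒same : T ((a ≡ᵇ c) ∧ (b ≡ᵇ d)) → T (a * x + b ≡ᵇ c * x + d)
  digits⇒same t with ta , tb ← Equivalence.to (T-∧ {a ≡ᵇ c}) t =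
    ≡⇒≡ᵇ _ _ (cong₂ (λ q r → q * x + r) (≡ᵇ⇒≡ a c ta) (≡ᵇ⇒≡ b d tb))

agreeOutside-combine : ∀ (P : Subset M) (n₂ a b c d : Vec ℕ M) →
  Pointwise _<_ b n₂ → Pointwise _<_ d n₂ →
  agreeOutside P (combine a n₂ b) (combine c n₂ d) ≡ (agreeOutside P a c ∧ agreeOutside P b d)
agreeOutside-combine [] [] [] [] [] [] [] [] = refl
agreeOutside-combine (true ∷ P) (x ∷ n₂) (_ ∷ a) (_ ∷ b) (_ ∷ c) (_ ∷ d) (_ ∷ b<n) (_ ∷ d<n) =
  agreeOutside-combine P n₂ a b c d b<n d<n
agreeOutside-combine (false ∷ P) (x ∷ n₂) (a₀ ∷ a) (b₀ ∷ b) (c₀ ∷ c) (d₀ ∷ d) (b₀<x ∷ b<n) (d₀<x ∷ d<n) =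
  trans (cong₂ _∧_ (digits-≡ᵇ a₀ b₀ c₀ d₀ b₀<x d₀<x) (agreeOutside-combine P n₂ a b c d b<n d<n))
        (∧-interchange (a₀ ≡ᵇ c₀) (b₀ ≡ᵇ d₀) _ _)

lineCount-guarded : ∀ (n : Vec ℕ M) (T : Multiset M) P c →
  lineCount n T P c ≡ sumBox n (λ v → guard (agreeOutside P v c) (T v))
lineCount-guarded n T P c = sumOver-filter (λ v → agreeOutside P v c) (box n) T

-- n with the coordinates in P replaced by 1.  The points of its box are the
-- representatives (zero on P) of the lines in direction P.
collapse : Subset M → Vec ℕ M → Vec ℕ M
collapse []          []      = []
collapse (true ∷ P)  (_ ∷ n) = 1 ∷ collapse P n
collapse (false ∷ P) (x ∷ n) = x ∷ collapse P n

collapse-bound : ∀ (P : Subset M) (n c : Vec ℕ M) → Positive n →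
  Pointwise _<_ c (collapse P n) → Pointwise _<_ c n
collapse-bound []          []      []      _           []            = []
collapse-bound (true ∷ P)  (x ∷ n) (y ∷ c) (0<x , pos) (y<1 ∷ c<n) = <-≤-trans y<1 0<x ∷ collapse-bound P n c pos c<n
collapse-bound (false ∷ P) (x ∷ n) (y ∷ c) (_ , pos)   (y<x ∷ c<n) = y<x ∷ collapse-bound P n c pos c<n

collapse-count : ∀ (P : Subset M) (n : Vec ℕ M) (c : ℕ) →
  sumBox (collapse P n) (λ _ → c) ≡ prodOutside P n * c
collapse-count []          []      c = refl
collapse-count (true ∷ P)  (x ∷ n) c =
  trans (sumBox-∷ 1 (collapse P n) (λ _ → c)) (trans (+-identityʳ _) (collapse-count P n c))
collapse-count (false ∷ P) (x ∷ n) c = begin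
  sumBox (x ∷ collapse P n) (λ _ → c)               ≡⟨ sumBox-∷ x (collapse P n) (λ _ → c) ⟩
  sumUpTo x (λ _ → sumBox (collapse P n) (λ _ → c)) ≡⟨ sumOver-≗ (upTo x) (λ _ → collapse-count P n c) ⟩
  sumUpTo x (λ _ → prodOutside P n * c)             ≡⟨ sumOver-const (upTo x) _ ⟩
  length (upTo x) * (prodOutside P n * c)           ≡⟨ cong (_* (prodOutside P n * c)) (length-upTo x) ⟩
  x * (prodOutside P n * c)                         ≡⟨ sym (*-assoc x (prodOutside P n) c) ⟩
  x * prodOutside P n * c                           ∎
  where open ≡-Reasoning

sumBox-fibres : ∀ (P : Subset M) (n : Vec ℕ M) (f : Vec ℕ M → ℕ) →
  sumBox n f ≡ sumBox (collapse P n) (λ c → sumBox n (λ v → guard (agreeOutside P v c) (f v)))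
sumBox-fibres []          []      f = sym (+-identityʳ _)
sumBox-fibres (true ∷ P)  (x ∷ n) f = begin
  sumBox (x ∷ n) f
    ≡⟨ sumBox-∷ x n f ⟩
  sumUpTo x (λ i → sumBox n (λ v → f (i ∷ v)))
    ≡⟨ sumOver-≗ (upTo x) (λ i → sumBox-fibres P n (λ v → f (i ∷ v))) ⟩
  sumUpTo x (λ i → sumBox (collapse P n) (λ c → line c i))
    ≡⟨ sumOver-swap (upTo x) (box (collapse P n)) (λ i c → line c i) ⟩
  sumBox (collapse P n) (λ c → sumUpTo x (line c))
    ≡⟨ sumOver-≗ (box (collapse P n)) (λ c → sym (sumBox-∷ x n (λ v → guard (agreeOutside (true ∷ P) v (0 ∷ c)) (f v)))) ⟩
  sumBox (collapse P n) (λ c → sumBox (x ∷ n) (λ v → guard (agreeOutside (true ∷ P) v (0 ∷ c)) (f v)))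
    ≡⟨ sym (trans (sumBox-∷ 1 (collapse P n) _) (+-identityʳ _)) ⟩
  sumBox (1 ∷ collapse P n) (λ c → sumBox (x ∷ n) (λ v → guard (agreeOutside (true ∷ P) v c) (f v)))  ∎
  where
  open ≡-Reasoning
  line : Vec ℕ _ → ℕ → ℕ
  line c i = sumBox n (λ v → guard (agreeOutside P v c) (f (i ∷ v)))
sumBox-fibres (false ∷ P) (x ∷ n) f = sym (begin
  sumBox (x ∷ collapse P n) F
    ≡⟨ sumBox-∷ x (collapse P n) F ⟩
  sumUpTo x (λ j → sumBox (collapse P n) (λ c → F (j ∷ c)))
    ≡⟨ sumOver-≗ (upTo x) (λ j → sumOver-≗ (box (collapse P n)) (λ c → F-as-δ j c)) ⟩
  sumUpTo x (λ j → sumBox (collapse P n) (λ c → sumUpTo x (λ i → guard (i ≡ᵇ j) (line c i))))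
    ≡⟨ sumOver-≗ (upTo x) (λ j → sumOver-swap (box (collapse P n)) (upTo x) (λ c i → guard (i ≡ᵇ j) (line c i))) ⟩
  sumUpTo x (λ j → sumUpTo x (λ i → sumBox (collapse P n) (λ c → guard (i ≡ᵇ j) (line c i))))
    ≡⟨ sumOver-≗ (upTo x) (λ j → sumOver-≗ (upTo x) (λ i → sumOver-guard (i ≡ᵇ j) (box (collapse P n)) (λ c → line c i))) ⟩
  sumUpTo x (λ j → sumUpTo x (λ i → guard (i ≡ᵇ j) (sumBox (collapse P n) (λ c → line c i))))
    ≡⟨ sumOver-cong (upTo x) (λ j j∈upTo → sumUpTo-δ (λ i → sumBox (collapse P n) (λ c → line c i)) (∈-upTo⁻ j∈upTo)) ⟩
  sumUpTo x (λ j → sumBox (collapse P n) (λ c → line c j))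
    ≡⟨ sumOver-≗ (upTo x) (λ j → sym (sumBox-fibres P n (λ v → f (j ∷ v)))) ⟩
  sumUpTo x (λ j → sumBox n (λ v → f (j ∷ v)))
    ≡⟨ sym (sumBox-∷ x n f) ⟩
  sumBox (x ∷ n) f  ∎)
  where
  open ≡-Reasoning
  line : Vec ℕ _ → ℕ → ℕ
  line c i = sumBox n (λ v → guard (agreeOutside P v c) (f (i ∷ v)))
  F : Vec ℕ _ → ℕ
  F c = sumBox (x ∷ n) (λ v → guard (agreeOutside (false ∷ P) v c) (f v))
  -- the line through j ∷ c only meets the slice with first coordinate j
  F-as-δ : ∀ j c → F (j ∷ c) ≡ sumUpTo x (λ i → guard (i ≡ᵇ j) (line c i))
  F-as-δ j c = trans (sumBox-∷ x n _) (sumOver-≗ (upTo x) (λ i →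
    trans (sumOver-≗ (box n) (λ v → guard-∧ (i ≡ᵇ j) (agreeOutside P v c) (f (i ∷ v))))
          (sumOver-guard (i ≡ᵇ j) (box n) (λ v → guard (agreeOutside P v c) (f (i ∷ v))))))

-- |T| ≤ L_P ∏_{j∉P} n_j: each of the ∏_{j∉P} n_j lines carries at most L_P points.
size-bound : ∀ k (n : Vec ℕ M) (L : Subset M → ℕ) (T : Multiset M) → Positive n → IsMultiTransversal k n L T →
  (P : Subset M) → P HasSize k → size n T ≤ L P * prodOutside P n
size-bound k n L T pos transversal P |P|≡k = begin
  size n T
    ≡⟨ sumBox-fibres P n T ⟩
  sumBox (collapse P n) (λ c → sumBox n (λ v → guard (agreeOutside P v c) (T v)))
    ≡⟨ sumOver-≗ (box (collapse P n)) (λ c → sym (lineCount-guarded n T P c)) ⟩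
  sumBox (collapse P n) (lineCount n T P)
    ≤⟨ sumOver-mono (box (collapse P n)) (λ c c∈box →
         transversal P |P|≡k c (box-complete n c (collapse-bound P n c pos (box-sound (collapse P n) c c∈box)))) ⟩
  sumBox (collapse P n) (λ _ → L P)
    ≡⟨ collapse-count P n (L P) ⟩
  prodOutside P n * L P
    ≡⟨ *-comm (prodOutside P n) (L P) ⟩
  L P * prodOutside P n  ∎
  where open ≤-Reasoning

size-at-minimiser : ∀ k (n : Vec ℕ M) (L : Subset M → ℕ) (T : Multiset M) → Positive n →
  IsMultiTransversal k n L T → IsFull k n L T →
  (A : Subset M) → A HasSize k →
  ((P : Subset M) → P HasSize k → L A * prodOutside A n ≤ L P * prodOutside P n) →
  size n T ≡ L A * prodOutside A n
size-at-minimiser k n L T pos transversal (P , |P|≡k , size≡) A |A|≡k minimal =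
  ≤-antisym (size-bound k n L T pos transversal A |A|≡k)
            (subst (L A * prodOutside A n ≤_) (sym size≡) (minimal P |P|≡k))

prodOutside-zipWith : ∀ (P : Subset M) (n₁ n₂ : Vec ℕ M) →
  prodOutside P (zipWith _*_ n₁ n₂) ≡ prodOutside P n₁ * prodOutside P n₂
prodOutside-zipWith []          []         []         = refl
prodOutside-zipWith (true ∷ P)  (_ ∷ n₁)  (_ ∷ n₂)  = prodOutside-zipWith P n₁ n₂
prodOutside-zipWith (false ∷ P) (x₁ ∷ n₁) (x₂ ∷ n₂) =
  trans (cong (x₁ * x₂ *_) (prodOutside-zipWith P n₁ n₂))
        (*-interchange x₁ x₂ (prodOutside P n₁) (prodOutside P n₂))

module _ (n₁ n₂ : Vec ℕ M) (T₁ T₂ T : Multiset M)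
         (T-product : (a b : Vec ℕ M) → a ∈ box n₁ → b ∈ box n₂ →
                      T (combine a n₂ b) ≡ T₁ a * T₂ b) where

  lineCount-combine : ∀ P c₁ c₂ → Pointwise _<_ c₂ n₂ →
    lineCount (zipWith _*_ n₁ n₂) T P (combine c₁ n₂ c₂) ≡ lineCount n₁ T₁ P c₁ * lineCount n₂ T₂ P c₂
  lineCount-combine P c₁ c₂ c₂<n₂ = begin
    lineCount (zipWith _*_ n₁ n₂) T P (combine c₁ n₂ c₂)
      ≡⟨ lineCount-guarded (zipWith _*_ n₁ n₂) T P (combine c₁ n₂ c₂) ⟩
    sumBox (zipWith _*_ n₁ n₂) (λ v → guard (agreeOutside P v (combine c₁ n₂ c₂)) (T v))
      ≡⟨ sumBox-factor n₁ n₂ _ _ _ guarded-product ⟩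
    sumBox n₁ (λ a → guard (agreeOutside P a c₁) (T₁ a)) * sumBox n₂ (λ b → guard (agreeOutside P b c₂) (T₂ b))
      ≡⟨ sym (cong₂ _*_ (lineCount-guarded n₁ T₁ P c₁) (lineCount-guarded n₂ T₂ P c₂)) ⟩
    lineCount n₁ T₁ P c₁ * lineCount n₂ T₂ P c₂  ∎
    where
    open ≡-Reasoning
    guarded-product : ∀ a b → a ∈ box n₁ → b ∈ box n₂ →
      guard (agreeOutside P (combine a n₂ b) (combine c₁ n₂ c₂)) (T (combine a n₂ b))
        ≡ guard (agreeOutside P a c₁) (T₁ a) * guard (agreeOutside P b c₂) (T₂ b)
    guarded-product a b a∈box b∈box =
      trans (cong₂ guard (agreeOutside-combine P n₂ a b c₁ c₂ (box-sound n₂ b b∈box) c₂<n₂)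
                         (T-product a b a∈box b∈box))
            (guard-* (agreeOutside P a c₁) (agreeOutside P b c₂) (T₁ a) (T₂ b))

  product-transversal : ∀ k (L₁ L₂ : Subset M → ℕ) →
    IsMultiTransversal k n₁ L₁ T₁ → IsMultiTransversal k n₂ L₂ T₂ →
    IsMultiTransversal k (zipWith _*_ n₁ n₂) (λ P → L₁ P * L₂ P) T
  product-transversal k L₁ L₂ transversal₁ transversal₂ P |P|≡k c c∈box
    with c₁ , c₂ , c₁<n₁ , c₂<n₂ , refl ← combine-surjective n₁ n₂ c (box-sound _ c c∈box) =
    subst (_≤ L₁ P * L₂ P) (sym (lineCount-combine P c₁ c₂ c₂<n₂))
      (*-mono-≤ (transversal₁ P |P|≡k c₁ (box-complete n₁ c₁ c₁<n₁))
                (transversal₂ P |P|≡k c₂ (box-complete n₂ c₂ c₂<n₂)))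

  size-product : size (zipWith _*_ n₁ n₂) T ≡ size n₁ T₁ * size n₂ T₂
  size-product = sumBox-factor n₁ n₂ T T₁ T₂ T-product

  product-full-at : ∀ k (L₁ L₂ : Subset M → ℕ) (A : Subset M) → A HasSize k →
    size n₁ T₁ ≡ L₁ A * prodOutside A n₁ → size n₂ T₂ ≡ L₂ A * prodOutside A n₂ →
    IsFull k (zipWith _*_ n₁ n₂) (λ P → L₁ P * L₂ P) T
  product-full-at k L₁ L₂ A |A|≡k size₁≡ size₂≡ = A , |A|≡k , (begin
    size (zipWith _*_ n₁ n₂) T                                  ≡⟨ size-product ⟩
    size n₁ T₁ * size n₂ T₂                                     ≡⟨ cong₂ _*_ size₁≡ size₂≡ ⟩
    L₁ A * prodOutside A n₁ * (L₂ A * prodOutside A n₂)         ≡⟨ *-interchange (L₁ A) _ _ _ ⟩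
    L₁ A * L₂ A * (prodOutside A n₁ * prodOutside A n₂)         ≡⟨ cong (L₁ A * L₂ A *_) (sym (prodOutside-zipWith A n₁ n₂)) ⟩
    L₁ A * L₂ A * prodOutside A (zipWith _*_ n₁ n₂)             ∎)
    where open ≡-Reasoning

proposition7p11 :
    (M k : ℕ) → 1 ≤ k → k ≤ M →
    (n₁ n₂ : Vec ℕ M) → Positive n₁ → Positive n₂ →
    (L₁ L₂ : Subset M → ℕ) → (T₁ T₂ T : Multiset M) →
    IsMultiTransversal k n₁ L₁ T₁ → IsMultiTransversal k n₂ L₂ T₂ →
    ((a b : Vec ℕ M) → a ∈ box n₁ → b ∈ box n₂ →
      T (combine a n₂ b) ≡ T₁ a * T₂ b) →
    IsMultiTransversal k (zipWith _*_ n₁ n₂) (λ P → L₁ P * L₂ P) T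
    × (IsFull k n₁ L₁ T₁ → IsFull k n₂ L₂ T₂ →
       (Σ (Subset M) λ A → A HasSize k
         × ((P : Subset M) → P HasSize k →
              L₁ A * prodOutside A n₁ ≤ L₁ P * prodOutside P n₁)
         × ((P : Subset M) → P HasSize k →
              L₂ A * prodOutside A n₂ ≤ L₂ P * prodOutside P n₂)) →
       IsFull k (zipWith _*_ n₁ n₂) (λ P → L₁ P * L₂ P) T)
proposition7p11 M k _ _ n₁ n₂ pos₁ pos₂ L₁ L₂ T₁ T₂ T transversal₁ transversal₂ T-product =
  product-transversal n₁ n₂ T₁ T₂ T T-product k L₁ L₂ transversal₁ transversal₂ ,
  λ { full₁ full₂ (A , |A|≡k , minimal₁ , minimal₂) →
        product-full-at n₁ n₂ T₁ T₂ T T-product k L₁ L₂ A |A|≡k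
          (size-at-minimiser k n₁ L₁ T₁ pos₁ transversal₁ full₁ A |A|≡k minimal₁)
          (size-at-minimiser k n₂ L₂ T₂ pos₂ transversal₂ full₂ A |A|≡k minimal₂) }
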